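{- Fix an integer $t\ge 2$ and set $\lambda=\langle n,n-t,n-2t,n-3t\rangle$. Then there exists $N(t)$ such that for all integers $n\ge N(t)$ the rank-generating function $F_{\lambda}(q)$ is not unimodal.
   Context: For a partition with distinct parts $\lambda=\langle \lambda_1,\dots,\lambda_b\rangle$ (so $\lambda_1>\lambda_2>\dots>\lambda_b\ge 1$), a partition $\mu$ is contained in the shifted Ferrers shape $\lambda$ if $\mu=\langle\mu_1,\dots,\mu_k\rangle$ has distinct parts, $k\le b$, and $\mu_i\le\lambda_i$ for all $i\le k$ (the empty partition is included). The rank-generating function is $F_{\lambda}(q)=\sum_{\mu} q^{|\mu|}$, the sum over all such $\mu$, where $|\mu|$ is the sum of the parts of $\mu$. A polynomial $\sum_i c_iq^i$ is unimodal if there is an index $m$ with $c_0\le c_1\le\dots\le c_m\ge c_{m+1}\ge\dots$. -}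

module Defs where

open import Data.Nat using (ℕ; zero; suc; _+_; _≤_; _<_; _≤ᵇ_; _<ᵇ_; _≡ᵇ_)
open import Data.Bool using (Bool; true; false; _∧_)
open import Data.List using (List; []; _∷_; map; concatMap; filter; length; upTo; _++_)
open import Data.Product using (Σ; _×_; ∃-syntax)
open import Relation.Binary.PropositionalEquality using (_≡_)
open import Relation.Nullary using (¬_)
open import Data.Bool.Properties using (T?)
open import Data.Bool using (T)
open import Data.Nat.ListAction using (sum)

listsOfLength : ℕ → ℕ → List (List ℕ)
listsOfLength zero    m = [] ∷ []
listsOfLength (suc k) m = concatMap (λ x → map (x ∷_) (listsOfLength k m)) (upTo (suc m))

listsUpTo : ℕ → ℕ → List (List ℕ)
listsUpTo b m = concatMap (λ k → listsOfLength k m) (upTo (suc b))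

distinctParts : List ℕ → Bool
distinctParts []           = true
distinctParts (x ∷ [])     = 1 ≤ᵇ x
distinctParts (x ∷ y ∷ xs) = (y <ᵇ x) ∧ distinctParts (y ∷ xs)

partwiseBelow : List ℕ → List ℕ → Bool
partwiseBelow []       _        = true
partwiseBelow (_ ∷ _)  []       = false
partwiseBelow (m ∷ μ)  (l ∷ λ') = (m ≤ᵇ l) ∧ partwiseBelow μ λ'

-- μ is contained in the shifted Ferrers shape λ.
containedIn : List ℕ → List ℕ → Bool
containedIn μ λ' = distinctParts μ ∧ partwiseBelow μ λ'

headOr0 : List ℕ → ℕ
headOr0 []      = 0
headOr0 (x ∷ _) = x

-- All partitions μ contained in the shifted shape λ (each exactly once):
-- every such μ has length ≤ length λ and entries ≤ λ₁.
shiftedSubshapes : List ℕ → List (List ℕ)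
shiftedSubshapes λ' = filter (λ μ → T? (containedIn μ λ'))
                             (listsUpTo (length λ') (headOr0 λ'))

rankGenCoeff : List ℕ → ℕ → ℕ
rankGenCoeff λ' i = length (filter (λ μ → T? (sum μ ≡ᵇ i)) (shiftedSubshapes λ'))

Unimodal : (ℕ → ℕ) → Set
Unimodal c = ∃[ m ] ((∀ i → suc i ≤ m → c i ≤ c (suc i))
                    × (∀ i → m ≤ i → c (suc i) ≤ c i))

module Submission where

-- Put N = 2n − 1.  A partition μ ⊆ λ of size N has between two and four parts, so it is a quadruple
-- (a, b, c, d) padded with zeros.  We inject the partitions of size N into those of size N − 1 and
-- into those of size N + 1, each time missing one partition; so the coefficients of q^(N−1), q^N,
-- q^(N+1) form a strict dip.  Downwards, a is lowered if a ≥ b + 2; otherwise a = b + 1 and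
-- (a, b, c, d) ↦ (n, n−1−c, n−1−b, b+c−n), and (n, n−t, t−2, 0) is missed.  Upwards, a is raised
-- if a < n.  Otherwise a = n, and the image is (n−c, n−1−c, c+d+1, c−d) if t ≤ c + 1 and
-- 2c + d + 3 ≤ n; in the remaining cases it is (n−u, n−1−u, 2u+1, 0) for some u ≥ t that encodes
-- (c, d), and the partition of this form with u = t − 1 is missed.  The bound n ≥ 6t² + 6t + 10
-- keeps all these images inside λ.

open import Defs
open import Data.Bool using (_∧_; T; if_then_else_)
open import Data.Bool.Properties using (T?; T-∧)
open import Data.Empty using (⊥-elim)
open import Data.List using (List; []; _∷_; _++_; map; filter; length; upTo; concatMap; cartesianProductWith)
open import Data.List.Properties using (length-removeAt′; ∷-injective)
open import Data.List.Membership.Propositional using (_∈_; _─_)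
open import Data.List.Membership.Propositional.Properties using (∈-filter⁻; ∈-filter⁺; ∈-concatMap⁺; ∈-upTo⁺; ∈-cartesianProductWith⁺; ∈-cartesianProductWith⁻)
open import Data.List.Relation.Unary.All as All using (All)
import Data.List.Relation.Unary.All.Properties as All
open import Data.List.Relation.Unary.Any as Any using (here; there)
import Data.List.Relation.Unary.AllPairs as AllPairs
import Data.List.Relation.Unary.AllPairs.Properties as AllPairs
open import Data.List.Relation.Unary.Unique.Propositional using (Unique)
import Data.List.Relation.Unary.Unique.Propositional.Properties as Unique
open import Data.Nat
open import Data.Nat.Properties
open import Data.Nat.DivMod using (_%_; m<n⇒m%n≡m; [m+kn]%n≡m%n)
open import Data.Nat.ListAction using (sum)
open import Data.Nat.Tactic.RingSolver using (solve; solve-∀)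
open import Data.Product using (∃; ∃-syntax; _×_; _,_; proj₁; proj₂)
open import Data.Sum using (_⊎_; inj₁; inj₂; [_,_]′)
open import Function using (_∘_; id; Equivalence)
open import Relation.Binary.PropositionalEquality
open import Relation.Nullary using (¬_; yes; no; does; contradiction)
open import Relation.Nullary.Decidable using (dec-true; dec-false)

private variable
  A B C : Set

-- Counting by injections

∈-─⁺ : ∀ {x z : A} {ys} (x∈ys : x ∈ ys) → z ∈ ys → z ≢ x → z ∈ ys ─ x∈ys
∈-─⁺ (here refl)  (here refl)  z≢x = ⊥-elim (z≢x refl)
∈-─⁺ (here _)     (there z∈ys) _   = z∈ys
∈-─⁺ (there _)    (here z≡y)   _   = here z≡y
∈-─⁺ (there x∈ys) (there z∈ys) z≢x = there (∈-─⁺ x∈ys z∈ys z≢x)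

module _ (f : A → B) where

  InjectiveOn : List A → Set
  InjectiveOn xs = ∀ {x y} → x ∈ xs → y ∈ xs → f x ≡ f y → x ≡ y

  length-≤-by-injection : ∀ {xs ys} → Unique xs → (∀ {x} → x ∈ xs → f x ∈ ys) →
    InjectiveOn xs → length xs ≤ length ys
  length-≤-by-injection {[]}     _               _    _   = z≤n
  length-≤-by-injection {x ∷ xs} {ys} (x∉xs AllPairs.∷ xs!) into inj =
    ≤-trans (s≤s (length-≤-by-injection xs! into′ (λ p q → inj (there p) (there q))))
            (≤-reflexive (sym (length-removeAt′ ys _)))
    where
    fx∈ys : f x ∈ ys
    fx∈ys = into (here refl)
    into′ : ∀ {y} → y ∈ xs → f y ∈ ys ─ fx∈ys
    into′ y∈xs = ∈-─⁺ fx∈ys (into (there y∈xs))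
      (λ fy≡fx → All.lookup x∉xs y∈xs (sym (inj (there y∈xs) (here refl) fy≡fx)))

  length-<-by-injection : ∀ {xs ys y₀} → Unique xs → (∀ {x} → x ∈ xs → f x ∈ ys) →
    InjectiveOn xs → y₀ ∈ ys → (∀ {x} → x ∈ xs → f x ≢ y₀) → length xs < length ys
  length-<-by-injection {ys = ys} xs! into inj y₀∈ys missed =
    ≤-trans (s≤s (length-≤-by-injection xs! (λ x∈xs → ∈-─⁺ y₀∈ys (into x∈xs) (missed x∈xs)) inj))
            (≤-reflexive (sym (length-removeAt′ ys _)))

-- Enumerating the subshapes of a given size

concatMap-map≡cartesianProductWith : ∀ (f : A → B → C) xs ys →
  concatMap (λ x → map (f x) ys) xs ≡ cartesianProductWith f xs ys
concatMap-map≡cartesianProductWith f []       ys = refl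
concatMap-map≡cartesianProductWith f (x ∷ xs) ys =
  cong (map (f x) ys ++_) (concatMap-map≡cartesianProductWith f xs ys)

listsOfLength-suc : ∀ k m →
  listsOfLength (suc k) m ≡ cartesianProductWith _∷_ (upTo (suc m)) (listsOfLength k m)
listsOfLength-suc k m = concatMap-map≡cartesianProductWith _∷_ (upTo (suc m)) (listsOfLength k m)

listsOfLength-unique : ∀ k m → Unique (listsOfLength k m)
listsOfLength-unique zero    m = All.[] AllPairs.∷ AllPairs.[]
listsOfLength-unique (suc k) m rewrite listsOfLength-suc k m =
  Unique.cartesianProductWith⁺ _∷_ ∷-injective (Unique.upTo⁺ (suc m)) (listsOfLength-unique k m)

∈-listsOfLength⁻ : ∀ k m {μ} → μ ∈ listsOfLength k m → length μ ≡ k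
∈-listsOfLength⁻ zero    m (here refl) = refl
∈-listsOfLength⁻ (suc k) m μ∈ rewrite listsOfLength-suc k m
  with _ , _ , _ , ν∈ , refl ← ∈-cartesianProductWith⁻ _∷_ (upTo (suc m)) (listsOfLength k m) μ∈
  = cong suc (∈-listsOfLength⁻ k m ν∈)

∈-listsOfLength⁺ : ∀ m {μ} → All (_≤ m) μ → μ ∈ listsOfLength (length μ) m
∈-listsOfLength⁺ m All.[]                = here refl
∈-listsOfLength⁺ m {x ∷ μ} (x≤m All.∷ μ≤m) rewrite listsOfLength-suc (length μ) m =
  ∈-cartesianProductWith⁺ _∷_ (∈-upTo⁺ (s≤s x≤m)) (∈-listsOfLength⁺ m μ≤m)

listsUpTo-unique : ∀ b m → Unique (listsUpTo b m)
listsUpTo-unique b m = Unique.concat⁺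
  (All.map⁺ (All.universal (λ k → listsOfLength-unique k m) (upTo (suc b))))
  (AllPairs.map⁺ (AllPairs.map disjoint (Unique.upTo⁺ (suc b))))
  where
  disjoint : ∀ {k k′} → k ≢ k′ → ∀ {μ} → ¬ (μ ∈ listsOfLength k m × μ ∈ listsOfLength k′ m)
  disjoint k≢k′ (μ∈ , μ∈′) = k≢k′ (trans (sym (∈-listsOfLength⁻ _ m μ∈)) (∈-listsOfLength⁻ _ m μ∈′))

∈-listsUpTo⁺ : ∀ b m {μ} → length μ ≤ b → All (_≤ m) μ → μ ∈ listsUpTo b m
∈-listsUpTo⁺ b m {μ} len≤b μ≤m =
  ∈-concatMap⁺ (λ k → listsOfLength k m) (Any.map (λ { refl → ∈-listsOfLength⁺ m μ≤m }) (∈-upTo⁺ (s≤s len≤b)))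

T-∧⁺ : ∀ {x y} → T x → T y → T (x ∧ y)
T-∧⁺ p q = Equivalence.from T-∧ (p , q)

T-∧⁻ : ∀ {x y} → T (x ∧ y) → T x × T y
T-∧⁻ = Equivalence.to T-∧

-- A record rather than T (containedIn μ λ') itself: the latter unfolds to a Boolean formula,
-- from which μ and λ' could no longer be inferred.
record _⊑_ (μ λ' : List ℕ) : Set where
  constructor contained
  field holds : T (containedIn μ λ')

⊑-∷⁻ : ∀ {x y l μ λ'} → (x ∷ y ∷ μ) ⊑ (l ∷ λ') → y < x × x ≤ l × (y ∷ μ) ⊑ λ'
⊑-∷⁻ {x} {y} {l} (contained p) =
  let distinct , below = T-∧⁻ p
      y<ᵇx , distinct′ = T-∧⁻ distinct
      x≤ᵇl , below′ = T-∧⁻ below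
  in <ᵇ⇒< y x y<ᵇx , ≤ᵇ⇒≤ x l x≤ᵇl , contained (T-∧⁺ distinct′ below′)

⊑-∷⁺ : ∀ {x y l μ λ'} → y < x → x ≤ l → (y ∷ μ) ⊑ λ' → (x ∷ y ∷ μ) ⊑ (l ∷ λ')
⊑-∷⁺ y<x x≤l (contained p) = let distinct , below = T-∧⁻ p in
  contained (T-∧⁺ (T-∧⁺ (<⇒<ᵇ y<x) distinct) (T-∧⁺ (≤⇒≤ᵇ x≤l) below))

⊑-[-]⁻ : ∀ {x l λ'} → (x ∷ []) ⊑ (l ∷ λ') → 1 ≤ x × x ≤ l
⊑-[-]⁻ {x} {l} (contained p) = let 1≤ᵇx , below = T-∧⁻ p in
  ≤ᵇ⇒≤ 1 x 1≤ᵇx , ≤ᵇ⇒≤ x l (proj₁ (T-∧⁻ below))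

⊑-[-]⁺ : ∀ {x l λ'} → 1 ≤ x → x ≤ l → (x ∷ []) ⊑ (l ∷ λ')
⊑-[-]⁺ 1≤x x≤l = contained (T-∧⁺ (≤⇒≤ᵇ 1≤x) (T-∧⁺ (≤⇒≤ᵇ x≤l) _))

⊑-[]⁻ : ∀ {x μ} → ¬ (x ∷ μ) ⊑ []
⊑-[]⁻ {x} {μ} (contained p) = proj₂ (T-∧⁻ {distinctParts (x ∷ μ)} p)

partwiseBelow⇒length-≤ : ∀ μ λ' → T (partwiseBelow μ λ') → length μ ≤ length λ'
partwiseBelow⇒length-≤ []      λ'        _ = z≤n
partwiseBelow⇒length-≤ (x ∷ μ) (l ∷ λ') p = s≤s (partwiseBelow⇒length-≤ μ λ' (proj₂ (T-∧⁻ p)))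

partwiseBelow⇒head-≤ : ∀ μ λ' → T (partwiseBelow μ λ') → headOr0 μ ≤ headOr0 λ'
partwiseBelow⇒head-≤ []      λ'        _ = z≤n
partwiseBelow⇒head-≤ (x ∷ μ) (l ∷ λ') p = ≤ᵇ⇒≤ x l (proj₁ (T-∧⁻ p))

distinctParts⇒All-≤-head : ∀ μ → T (distinctParts μ) → All (_≤ headOr0 μ) μ
distinctParts⇒All-≤-head []          _ = All.[]
distinctParts⇒All-≤-head (x ∷ [])    _ = ≤-refl All.∷ All.[]
distinctParts⇒All-≤-head (x ∷ y ∷ μ) p = let y<ᵇx , distinct = T-∧⁻ p in
  ≤-refl All.∷ All.map (λ z≤y → ≤-trans z≤y (<⇒≤ (<ᵇ⇒< y x y<ᵇx))) (distinctParts⇒All-≤-head (y ∷ μ) distinct)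

subshapesOfSize : List ℕ → ℕ → List (List ℕ)
subshapesOfSize λ' k = filter (λ μ → T? (sum μ ≡ᵇ k)) (shiftedSubshapes λ')

subshapesOfSize-unique : ∀ λ' k → Unique (subshapesOfSize λ' k)
subshapesOfSize-unique λ' k = Unique.filter⁺ (λ μ → T? (sum μ ≡ᵇ k))
  (Unique.filter⁺ (λ μ → T? (containedIn μ λ')) (listsUpTo-unique (length λ') (headOr0 λ')))

∈-subshapesOfSize⁻ : ∀ λ' k {μ} → μ ∈ subshapesOfSize λ' k → μ ⊑ λ' × sum μ ≡ k
∈-subshapesOfSize⁻ λ' k {μ} μ∈ =
  let μ∈shifted , sum≡ᵇk = ∈-filter⁻ (λ μ → T? (sum μ ≡ᵇ k)) {xs = shiftedSubshapes λ'} μ∈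
  in contained (proj₂ (∈-filter⁻ (λ μ → T? (containedIn μ λ')) {xs = listsUpTo (length λ') (headOr0 λ')} μ∈shifted))
   , ≡ᵇ⇒≡ (sum μ) k sum≡ᵇk

∈-subshapesOfSize⁺ : ∀ λ' k {μ} → μ ⊑ λ' → sum μ ≡ k → μ ∈ subshapesOfSize λ' k
∈-subshapesOfSize⁺ λ' k {μ} (contained μ⊆λ) sum≡k =
  ∈-filter⁺ (λ μ → T? (sum μ ≡ᵇ k)) (∈-filter⁺ (λ μ → T? (containedIn μ λ')) μ∈lists μ⊆λ) (≡⇒≡ᵇ (sum μ) k sum≡k)
  where
  μ∈lists : μ ∈ listsUpTo (length λ') (headOr0 λ')
  μ∈lists with distinct , below ← T-∧⁻ {distinctParts μ} μ⊆λ =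
    ∈-listsUpTo⁺ (length λ') (headOr0 λ') (partwiseBelow⇒length-≤ μ λ' below)
      (All.map (λ x≤hd → ≤-trans x≤hd (partwiseBelow⇒head-≤ μ λ' below)) (distinctParts⇒All-≤-head μ distinct))

-- Partitions with at most four parts

shape : ℕ → ℕ → List ℕ
shape n t = n ∷ (n ∸ t) ∷ (n ∸ 2 * t) ∷ (n ∸ 3 * t) ∷ []

record Quad : Set where
  constructor quad
  field a b c d : ℕ

size : Quad → ℕ
size (quad a b c d) = a + b + c + d

-- Zero parts only pad a partition to four entries: toList drops them, fromList restores them.
lowerParts : ℕ → ℕ → List ℕ
lowerParts zero    _       = []
lowerParts (suc c) zero    = suc c ∷ []
lowerParts (suc c) (suc d) = suc c ∷ suc d ∷ []

toList : Quad → List ℕ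
toList (quad a b c d) = a ∷ b ∷ lowerParts c d

fromList : List ℕ → Quad
fromList (a ∷ b ∷ c ∷ d ∷ _) = quad a b c d
fromList (a ∷ b ∷ c ∷ [])    = quad a b c 0
fromList (a ∷ b ∷ [])        = quad a b 0 0
fromList _                   = quad 0 0 0 0

record Fits (n t : ℕ) (q : Quad) : Set where
  constructor fits
  open Quad q
  field
    b<a       : b < a
    c<b       : c < b
    d<c⊎d≡0   : d < c ⊎ d ≡ 0
    a≤n       : a ≤ n
    b+t≤n     : b + t ≤ n
    c+2t≤n    : c + 2 * t ≤ n
    d+3t≤n    : d + 3 * t ≤ n

c<n : ∀ {n t q} → Fits n t q → Quad.c q < n
c<n {q = quad a b c d} F = <-≤-trans (<-trans c<b b<a) a≤n where open Fits F

Sized : ℕ → ℕ → ℕ → Quad → Set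
Sized n t k q = Fits n t q × size q ≡ k

fromList-toList : ∀ {a b c d} → d < c ⊎ d ≡ 0 → fromList (toList (quad a b c d)) ≡ quad a b c d
fromList-toList {c = zero}  {zero}  _          = refl
fromList-toList {c = zero}  {suc d} (inj₁ ())
fromList-toList {c = zero}  {suc d} (inj₂ ())
fromList-toList {c = suc c} {zero}  _          = refl
fromList-toList {c = suc c} {suc d} _          = refl

toList-injective : ∀ {n t q q′} → Fits n t q → Fits n t q′ → toList q ≡ toList q′ → q ≡ q′
toList-injective {q = quad _ _ _ _} {quad _ _ _ _} F F′ eq = begin
  _                      ≡⟨ fromList-toList (Fits.d<c⊎d≡0 F) ⟨
  fromList (toList _)    ≡⟨ cong fromList eq ⟩
  fromList (toList _)    ≡⟨ fromList-toList (Fits.d<c⊎d≡0 F′) ⟩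
  _                      ∎
  where open ≡-Reasoning

quad-≡-by-size : ∀ {a b c d b′} → size (quad a b c d) ≡ size (quad a b′ c d) → quad a b c d ≡ quad a b′ c d
quad-≡-by-size {a} {b} {c} {d} {b′} size≡ =
  cong (λ b → quad a b c d) (+-cancelˡ-≡ a b b′ (+-cancelʳ-≡ c _ _ (+-cancelʳ-≡ d _ _ size≡)))

sum-lowerParts : ∀ {c d} → d < c ⊎ d ≡ 0 → sum (lowerParts c d) ≡ c + d
sum-lowerParts {zero}  {zero}  _        = refl
sum-lowerParts {zero}  {suc d} (inj₁ ())
sum-lowerParts {zero}  {suc d} (inj₂ ())
sum-lowerParts {suc c} {zero}  _        = refl
sum-lowerParts {suc c} {suc d} _        = cong (suc c +_) (+-identityʳ (suc d))

sum-toList : ∀ {n t q} → Fits n t q → sum (toList q) ≡ size q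
sum-toList {q = quad a b c d} F = begin
  a + (b + sum (lowerParts c d)) ≡⟨ +-assoc a b _ ⟨
  a + b + sum (lowerParts c d)   ≡⟨ cong (a + b +_) (sum-lowerParts (Fits.d<c⊎d≡0 F)) ⟩
  a + b + (c + d)                ≡⟨ +-assoc (a + b) c d ⟨
  a + b + c + d                  ∎
  where open ≡-Reasoning

fits-from-bounds : ∀ {n t a b c d} → 3 * t ≤ n → b < a → c < b → d < c ⊎ d ≡ 0 → a ≤ n →
  b ≤ n ∸ t → c ≤ n ∸ 2 * t → d ≤ n ∸ 3 * t → Fits n t (quad a b c d)
fits-from-bounds {n} {t} {a} {b} {c} {d} 3t≤n b<a c<b d<c⊎d≡0 a≤n b≤ c≤ d≤ = fits b<a c<b d<c⊎d≡0 a≤n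
  (m≤o∸n⇒m+n≤o b (≤-trans (m≤n*m t 3) 3t≤n) b≤)
  (m≤o∸n⇒m+n≤o c (≤-trans (*-monoˡ-≤ t (n≤1+n 2)) 3t≤n) c≤)
  (m≤o∸n⇒m+n≤o d 3t≤n d≤)

fits⇒⊑ : ∀ {n t q} → Fits n t q → toList q ⊑ shape n t
fits⇒⊑ {q = quad a b zero zero} (fits b<a c<b _ a≤n b+t≤n _ _) =
  ⊑-∷⁺ b<a a≤n (⊑-[-]⁺ c<b (m+n≤o⇒m≤o∸n b b+t≤n))
fits⇒⊑ {q = quad a b zero (suc d)} (fits _ _ (inj₁ ()) _ _ _ _)
fits⇒⊑ {q = quad a b zero (suc d)} (fits _ _ (inj₂ ()) _ _ _ _)
fits⇒⊑ {q = quad a b (suc c) zero} (fits b<a c<b _ a≤n b+t≤n c+2t≤n _) =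
  ⊑-∷⁺ b<a a≤n (⊑-∷⁺ c<b (m+n≤o⇒m≤o∸n b b+t≤n)
    (⊑-[-]⁺ (s≤s z≤n) (m+n≤o⇒m≤o∸n (suc c) c+2t≤n)))
fits⇒⊑ {q = quad a b (suc c) (suc d)} (fits b<a c<b (inj₁ d<c) a≤n b+t≤n c+2t≤n d+3t≤n) =
  ⊑-∷⁺ b<a a≤n (⊑-∷⁺ c<b (m+n≤o⇒m≤o∸n b b+t≤n)
    (⊑-∷⁺ d<c (m+n≤o⇒m≤o∸n (suc c) c+2t≤n)
      (⊑-[-]⁺ (s≤s z≤n) (m+n≤o⇒m≤o∸n (suc d) d+3t≤n))))

⊑⇒fits : ∀ {n t} μ → 3 * t ≤ n → μ ⊑ shape n t → n < sum μ →
  Fits n t (fromList μ) × toList (fromList μ) ≡ μ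
⊑⇒fits [] _ _ ()
⊑⇒fits {n} (a ∷ []) _ μ⊆ n<a =
  ⊥-elim (<⇒≱ (subst (n <_) (+-identityʳ a) n<a) (proj₂ (⊑-[-]⁻ μ⊆)))
⊑⇒fits (a ∷ b ∷ []) 3t≤n μ⊆ _
  with b<a , a≤n , μ⊆ ← ⊑-∷⁻ μ⊆
  with 0<b , b≤ ← ⊑-[-]⁻ μ⊆
  = fits-from-bounds 3t≤n b<a 0<b (inj₂ refl) a≤n b≤ z≤n z≤n , refl
⊑⇒fits (a ∷ b ∷ zero ∷ []) _ μ⊆ _
  with _ , _ , μ⊆ ← ⊑-∷⁻ μ⊆
  with _ , _ , μ⊆ ← ⊑-∷⁻ μ⊆
  = contradiction (proj₁ (⊑-[-]⁻ μ⊆)) λ ()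
⊑⇒fits (a ∷ b ∷ suc c ∷ []) 3t≤n μ⊆ _
  with b<a , a≤n , μ⊆ ← ⊑-∷⁻ μ⊆
  with c<b , b≤ , μ⊆ ← ⊑-∷⁻ μ⊆
  = fits-from-bounds 3t≤n b<a c<b (inj₂ refl) a≤n b≤ (proj₂ (⊑-[-]⁻ μ⊆)) z≤n , refl
⊑⇒fits (a ∷ b ∷ c ∷ zero ∷ []) _ μ⊆ _
  with _ , _ , μ⊆ ← ⊑-∷⁻ μ⊆
  with _ , _ , μ⊆ ← ⊑-∷⁻ μ⊆
  with _ , _ , μ⊆ ← ⊑-∷⁻ μ⊆
  = contradiction (proj₁ (⊑-[-]⁻ μ⊆)) λ ()
⊑⇒fits (a ∷ b ∷ zero ∷ suc d ∷ []) _ μ⊆ _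
  with _ , _ , μ⊆ ← ⊑-∷⁻ μ⊆
  with _ , _ , μ⊆ ← ⊑-∷⁻ μ⊆
  = contradiction (proj₁ (⊑-∷⁻ μ⊆)) λ ()
⊑⇒fits (a ∷ b ∷ suc c ∷ suc d ∷ []) 3t≤n μ⊆ _
  with b<a , a≤n , μ⊆ ← ⊑-∷⁻ μ⊆
  with c<b , b≤ , μ⊆ ← ⊑-∷⁻ μ⊆
  with d<c , c≤ , μ⊆ ← ⊑-∷⁻ μ⊆
  = fits-from-bounds 3t≤n b<a c<b (inj₁ d<c) a≤n b≤ c≤ (proj₂ (⊑-[-]⁻ μ⊆)) , refl
⊑⇒fits (a ∷ b ∷ c ∷ d ∷ e ∷ μ) _ μ⊆ _
  with _ , _ , μ⊆ ← ⊑-∷⁻ μ⊆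
  with _ , _ , μ⊆ ← ⊑-∷⁻ μ⊆
  with _ , _ , μ⊆ ← ⊑-∷⁻ μ⊆
  with _ , _ , μ⊆ ← ⊑-∷⁻ μ⊆
  = ⊥-elim (⊑-[]⁻ μ⊆)

toList-∈ : ∀ {n t k q} → Sized n t k q → toList q ∈ subshapesOfSize (shape n t) k
toList-∈ (F , size≡k) = ∈-subshapesOfSize⁺ _ _ (fits⇒⊑ F) (trans (sum-toList F) size≡k)

∈⇒sized : ∀ {n t k μ} → 3 * t ≤ n → n < k → μ ∈ subshapesOfSize (shape n t) k →
  Sized n t k (fromList μ) × toList (fromList μ) ≡ μ
∈⇒sized {n} {μ = μ} 3t≤n n<k μ∈
  with μ⊑ , sum≡k ← ∈-subshapesOfSize⁻ _ _ μ∈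
  with F , toList≡μ ← ⊑⇒fits μ 3t≤n μ⊑ (subst (n <_) (sym sum≡k) n<k)
  = (F , trans (sym (sum-toList F)) (trans (cong sum toList≡μ) sum≡k)) , toList≡μ

-- Comparing neighbouring coefficients

record QuadInjection (n t k k′ : ℕ) : Set where
  field
    to           : Quad → Quad
    to-sized     : ∀ {q} → Sized n t k q → Sized n t k′ (to q)
    to-injective : ∀ {q q′} → Sized n t k q → Sized n t k q′ → to q ≡ to q′ → q ≡ q′
    missed       : Quad
    missed-sized : Sized n t k′ missed
    to-misses    : ∀ {q} → Sized n t k q → to q ≢ missed

rankGenCoeff-<-by-injection : ∀ {n t k k′} → 3 * t ≤ n → n < k → QuadInjection n t k k′ →
  rankGenCoeff (shape n t) k < rankGenCoeff (shape n t) k′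
rankGenCoeff-<-by-injection {n} {t} {k} {k′} 3t≤n n<k φ = length-<-by-injection (λ μ → toList (to (fromList μ)))
  (subshapesOfSize-unique (shape n t) k) into injective (toList-∈ missed-sized) misses
  where
  open QuadInjection φ
  decode : ∀ {μ} → μ ∈ subshapesOfSize (shape n t) k → Sized n t k (fromList μ) × toList (fromList μ) ≡ μ
  decode = ∈⇒sized 3t≤n n<k
  into : ∀ {μ} → μ ∈ subshapesOfSize (shape n t) k → toList (to (fromList μ)) ∈ subshapesOfSize (shape n t) k′
  into μ∈ = toList-∈ (to-sized (proj₁ (decode μ∈)))
  image-fits : ∀ {μ} → μ ∈ subshapesOfSize (shape n t) k → Fits n t (to (fromList μ))
  image-fits μ∈ = proj₁ (to-sized (proj₁ (decode μ∈)))
  injective : InjectiveOn (λ μ → toList (to (fromList μ))) (subshapesOfSize (shape n t) k)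
  injective {μ} {ν} μ∈ ν∈ eq = begin
    μ                    ≡⟨ proj₂ (decode μ∈) ⟨
    toList (fromList μ)  ≡⟨ cong toList (to-injective (proj₁ (decode μ∈)) (proj₁ (decode ν∈))
                                          (toList-injective (image-fits μ∈) (image-fits ν∈) eq)) ⟩
    toList (fromList ν)  ≡⟨ proj₂ (decode ν∈) ⟩
    ν                    ∎
    where open ≡-Reasoning
  misses : ∀ {μ} → μ ∈ subshapesOfSize (shape n t) k → toList (to (fromList μ)) ≢ toList missed
  misses μ∈ eq = to-misses (proj₁ (decode μ∈)) (toList-injective (image-fits μ∈) (proj₁ missed-sized) eq)

dip⇒¬Unimodal : ∀ {c : ℕ → ℕ} i → c (suc i) < c i → c (suc i) < c (suc (suc i)) → ¬ Unimodal c
dip⇒¬Unimodal i fall rise (peak , increasing , decreasing) with suc i ≤? peak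
... | yes i<peak = <⇒≱ fall (increasing i i<peak)
... | no  i≮peak = <⇒≱ rise (decreasing (suc i) (<⇒≤ (≰⇒> i≮peak)))

infixl 6 _⊕_
_⊕_ : ∀ {a b c d} → a ≤ b → c ≤ d → a + c ≤ b + d
_⊕_ = +-mono-≤

-- Linear facts below are proved by adding hypotheses with _⊕_ into X ≤ Y (or X ≡ Y)
-- and letting the ring solver check the bookkeeping identity x + Y ≡ y + X.
≤-linear : ∀ {x y X Y : ℕ} → X ≤ Y → x + Y ≡ y + X → x ≤ y
≤-linear {x} {y} {X} {Y} X≤Y eq = +-cancelʳ-≤ Y x y (≤-trans (≤-reflexive eq) (+-monoʳ-≤ y X≤Y))

≤-linear-scaled : ∀ k {x y X Y : ℕ} → X ≤ Y → suc k * x + Y ≡ suc k * y + X → x ≤ y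
≤-linear-scaled k X≤Y eq = *-cancelˡ-≤ (suc k) (≤-linear X≤Y eq)

≡-linear : ∀ {x y X Y : ℕ} → X ≡ Y → x + Y ≡ y + X → x ≡ y
≡-linear {x} {y} {X} {Y} X≡Y eq = +-cancelʳ-≡ Y x y (trans eq (cong (y +_) X≡Y))

x+x≤1+y+y⇒x≤y : ∀ {x y} → x + x ≤ suc (y + y) → x ≤ y
x+x≤1+y+y⇒x≤y {x} {y} le with x ≤? y
... | yes x≤y = x≤y
... | no  x≰y = contradiction 1≤0 λ ()
  where
  1≤0 : 1 ≤ 0
  1≤0 = ≤-linear (≰⇒> x≰y ⊕ ≰⇒> x≰y ⊕ le) (solve (x ∷ y ∷ []))

x+x≡y+y⇒x≡y : ∀ {x y} → x + x ≡ y + y → x ≡ y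
x+x≡y+y⇒x≡y {x} {y} eq = ≤-antisym (x+x≤1+y+y⇒x≤y (≤-trans (≤-reflexive eq) (n≤1+n (y + y))))
                                   (x+x≤1+y+y⇒x≤y (≤-trans (≤-reflexive (sym eq)) (n≤1+n (x + x))))

m∸n≤1+m∸[1+n] : ∀ m n → m ∸ n ≤ suc (m ∸ suc n)
m∸n≤1+m∸[1+n] zero    zero    = z≤n
m∸n≤1+m∸[1+n] zero    (suc n) = z≤n
m∸n≤1+m∸[1+n] (suc m) zero    = ≤-refl
m∸n≤1+m∸[1+n] (suc m) (suc n) = m∸n≤1+m∸[1+n] m n

digits-injective : ∀ {t c d c′ d′} .{{_ : NonZero t}} → d < t → d′ < t →
  d + c * t ≡ d′ + c′ * t → c ≡ c′ × d ≡ d′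
digits-injective {t} {c} {d} {c′} {d′} d<t d′<t eq = c≡c′ , d≡d′
  where
  open ≡-Reasoning
  d≡d′ : d ≡ d′
  d≡d′ = begin
    d                 ≡⟨ m<n⇒m%n≡m d<t ⟨
    d % t             ≡⟨ [m+kn]%n≡m%n d c t ⟨
    (d + c * t) % t   ≡⟨ cong (_% t) eq ⟩
    (d′ + c′ * t) % t ≡⟨ [m+kn]%n≡m%n d′ c′ t ⟩
    d′ % t            ≡⟨ m<n⇒m%n≡m d′<t ⟩
    d′                ∎
  c≡c′ : c ≡ c′
  c≡c′ = *-cancelʳ-≡ c c′ t (+-cancelˡ-≡ d _ _ (trans eq (cong (_+ c′ * t) (sym d≡d′))))

⌊/2⌋-injective-within-parity : ∀ {c c′} d d′ → 2 * c + d ≡ 2 * c′ + d′ → ⌊ d /2⌋ ≡ ⌊ d′ /2⌋ → d ≡ d′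
⌊/2⌋-injective-within-parity zero                zero                _  _ = refl
⌊/2⌋-injective-within-parity (suc zero)          (suc zero)          _  _ = refl
⌊/2⌋-injective-within-parity {c} {c′} zero       (suc zero)          eq _ =
  contradiction (trans (sym (+-identityʳ (2 * c))) (trans eq (+-comm (2 * c′) 1))) (even≢odd c c′)
⌊/2⌋-injective-within-parity {c} {c′} (suc zero) zero                eq _ =
  contradiction (trans (sym (+-identityʳ (2 * c′))) (trans (sym eq) (+-comm (2 * c) 1))) (even≢odd c′ c)
⌊/2⌋-injective-within-parity {c} {c′} (suc (suc d)) (suc (suc d′)) eq half≡ =
  cong (suc ∘ suc) (⌊/2⌋-injective-within-parity {suc c} {suc c′} d d′ (trans (shift c d) (trans eq (sym (shift c′ d′))))
                     (suc-injective half≡))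
  where
  shift : ∀ c d → 2 * suc c + d ≡ 2 * c + suc (suc d)
  shift = solve-∀

⌊n/2⌋+⌊n/2⌋≤n : ∀ n → ⌊ n /2⌋ + ⌊ n /2⌋ ≤ n
⌊n/2⌋+⌊n/2⌋≤n n = ≤-trans (+-monoʳ-≤ ⌊ n /2⌋ (⌊n/2⌋≤⌈n/2⌉ n)) (≤-reflexive (⌊n/2⌋+⌈n/2⌉≡n n))

x<y⇒1+x+x<y+y : ∀ {x y} → x < y → suc (x + x) < y + y
x<y⇒1+x+x<y+y {x} {y} x<y = ≤-linear (x<y ⊕ x<y) (solve (x ∷ y ∷ []))

y≤x⇒y+y<2+x+x : ∀ {x y} → y ≤ x → y + y < suc (suc (x + x))
y≤x⇒y+y<2+x+x {x} {y} y≤x = ≤-linear (y≤x ⊕ y≤x ⊕ z≤n {1}) (solve (x ∷ y ∷ []))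

-- The two injections, for partitions of size m + 1 = 2n − 1

module Construction {n t m : ℕ} (2≤t : 2 ≤ t) (n-large : 6 * (t * t) + 6 * t + 10 ≤ n)
                    (2+m≡n+n : 2 + m ≡ n + n) where

  3t≤n : 3 * t ≤ n
  3t≤n = ≤-linear (n-large ⊕ z≤n {3 * t + 6 * (t * t) + 10}) (solve (n ∷ t ∷ []))

  instance
    t-nonZero : NonZero t
    t-nonZero = >-nonZero (≤-trans (s≤s z≤n) 2≤t)

  t≤n : t ≤ n
  t≤n = ≤-trans (m≤n*m t 3) 3t≤n

  n<1+m : n < suc m
  n<1+m = ≤-linear (≤-reflexive (sym 2+m≡n+n) ⊕ 2≤t ⊕ 3t≤n ⊕ z≤n {2 * t}) (solve (n ∷ t ∷ m ∷ []))

  source-size : ∀ {q} → size q ≡ suc m → suc (size q) ≡ n + n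
  source-size size≡ = trans (cong suc size≡) 2+m≡n+n

  lower-size : ∀ {q} → suc (suc (size q)) ≡ n + n → size q ≡ m
  lower-size eq = suc-injective (suc-injective (trans eq (sym 2+m≡n+n)))

  data LowerCase : Quad → Set where
    shrink : ∀ {a b c d} → suc (suc b) ≤ a → LowerCase (quad a b c d)
    spread : ∀ {a b c d} → a ≤ suc b → LowerCase (quad a b c d)

  lowerCase : ∀ q → LowerCase q
  lowerCase (quad a b c d) with suc (suc b) ≤? a
  ... | yes 2+b≤a = shrink 2+b≤a
  ... | no  2+b≰a = spread (≤-pred (≰⇒> 2+b≰a))

  lowerWith : ∀ {q} → LowerCase q → Quad
  lowerWith {quad a b c d} (shrink _) = quad (pred a) b c d
  lowerWith {quad a b c d} (spread _) = quad n (n ∸ suc c) (n ∸ suc b) (c + b ∸ n)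

  lower : Quad → Quad
  lower q = lowerWith (lowerCase q)

  spread-t≤c : ∀ {b c d} → Fits n t (quad (suc b) b c d) → suc (suc b + b + c + d) ≡ n + n → t ≤ c
  spread-t≤c {b} {c} {d} F S = [ from-d<c , from-d≡0 ]′ d<c⊎d≡0
    where
    open Fits F
    from-d<c : d < c → t ≤ c
    from-d<c d<c = x+x≤1+y+y⇒x≤y
      (≤-linear (b+t≤n ⊕ b+t≤n ⊕ ≤-reflexive (sym S) ⊕ d<c) (solve (n ∷ t ∷ b ∷ c ∷ d ∷ [])))
    from-d≡0 : d ≡ 0 → t ≤ c
    from-d≡0 d≡0 =
      ≤-linear (b+t≤n ⊕ b+t≤n ⊕ ≤-reflexive (sym S) ⊕ 2≤t ⊕ ≤-reflexive d≡0) (solve (n ∷ t ∷ b ∷ c ∷ d ∷ []))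

  spread-n≤c+b : ∀ {b c d} → Fits n t (quad (suc b) b c d) → suc (suc b + b + c + d) ≡ n + n → n ≤ c + b
  spread-n≤c+b {b} {c} {d} F S = [ from-d<c , from-d≡0 ]′ (Fits.d<c⊎d≡0 F)
    where
    from-d<c : d < c → n ≤ c + b
    from-d<c d<c = x+x≤1+y+y⇒x≤y (≤-linear (≤-reflexive (sym S) ⊕ d<c) (solve (n ∷ b ∷ c ∷ d ∷ [])))
    from-d≡0 : d ≡ 0 → n ≤ c + b
    from-d≡0 d≡0 = ≤-linear-scaled 1 (≤-reflexive (sym S) ⊕ 2≤t ⊕ spread-t≤c F S ⊕ ≤-reflexive d≡0)
      (solve (n ∷ t ∷ b ∷ c ∷ d ∷ []))

  spread-sized : ∀ {b c d e₁ e₂ e₃} → Fits n t (quad (suc b) b c d) → suc (suc b + b + c + d) ≡ n + n →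
    e₁ + suc c ≡ n → e₂ + suc b ≡ n → e₃ + n ≡ c + b → Sized n t m (quad n e₁ e₂ e₃)
  spread-sized {b} {c} {d} {e₁} {e₂} {e₃} F S E₁ E₂ E₃ =
    fits e₁<n e₂<e₁ (inj₁ e₃<e₂) ≤-refl e₁+t≤n e₂+2t≤n e₃+3t≤n , lower-size {quad n e₁ e₂ e₃} size-eq
    where
    open Fits F
    n≤b+b : n ≤ b + b
    n≤b+b = [ from-d<c , from-d≡0 ]′ d<c⊎d≡0
      where
      from-d<c : d < c → n ≤ b + b
      from-d<c d<c = ≤-linear-scaled 1 (≤-reflexive (sym S) ⊕ c<b ⊕ c<b ⊕ d<c ⊕ z≤n {1})
        (solve (n ∷ b ∷ c ∷ d ∷ []))
      from-d≡0 : d ≡ 0 → n ≤ b + b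
      from-d≡0 d≡0 = ≤-linear-scaled 1 (≤-reflexive (sym S) ⊕ c<b ⊕ c<b ⊕ ≤-reflexive d≡0 ⊕ z≤n {c})
        (solve (n ∷ b ∷ c ∷ d ∷ []))
    e₁<n : e₁ < n
    e₁<n = ≤-linear (≤-reflexive E₁ ⊕ z≤n {c}) (solve (n ∷ c ∷ e₁ ∷ []))
    e₂<e₁ : e₂ < e₁
    e₂<e₁ = ≤-linear (≤-reflexive E₂ ⊕ ≤-reflexive (sym E₁) ⊕ c<b) (solve (n ∷ b ∷ c ∷ e₁ ∷ e₂ ∷ []))
    e₃<e₂ : e₃ < e₂
    e₃<e₂ = ≤-linear (≤-reflexive E₃ ⊕ ≤-reflexive (sym E₂) ⊕ ≤-reflexive S ⊕ z≤n {d})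
      (solve (n ∷ b ∷ c ∷ d ∷ e₂ ∷ e₃ ∷ []))
    e₁+t≤n : e₁ + t ≤ n
    e₁+t≤n = ≤-linear (≤-reflexive E₁ ⊕ spread-t≤c F S ⊕ z≤n {1}) (solve (n ∷ t ∷ c ∷ e₁ ∷ []))
    e₂+2t≤n : e₂ + 2 * t ≤ n
    e₂+2t≤n = ≤-linear-scaled 1 (≤-reflexive E₂ ⊕ ≤-reflexive E₂ ⊕ n-large ⊕ n≤b+b ⊕ z≤n {2 * t + 6 * (t * t) + 12})
      (solve (n ∷ t ∷ b ∷ e₂ ∷ []))
    e₃+3t≤n : e₃ + 3 * t ≤ n
    e₃+3t≤n = ≤-linear-scaled 1 (≤-reflexive E₃ ⊕ ≤-reflexive E₃ ⊕ ≤-reflexive S ⊕ ≤-reflexive S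
                                 ⊕ n-large ⊕ n≤b+b ⊕ z≤n {2 * d + 14 + 6 * (t * t)})
      (solve (n ∷ t ∷ b ∷ c ∷ d ∷ e₃ ∷ []))
    size-eq : suc (suc (n + e₁ + e₂ + e₃)) ≡ n + n
    size-eq = ≡-linear (cong₂ _+_ (cong₂ _+_ E₁ E₂) E₃) (solve (n ∷ b ∷ c ∷ e₁ ∷ e₂ ∷ e₃ ∷ []))

  lowerWith-sized : ∀ {q} (k : LowerCase q) → Sized n t (suc m) q → Sized n t m (lowerWith k)
  lowerWith-sized {quad (suc a) b c d} (shrink (s≤s b<a)) (fits _ c<b d<c⊎d≡0 a<n b+t≤n c+2t≤n d+3t≤n , size≡) =
    fits b<a c<b d<c⊎d≡0 (<⇒≤ a<n) b+t≤n c+2t≤n d+3t≤n , suc-injective size≡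
  lowerWith-sized {quad a b c d} (spread a≤1+b) (F , size≡) with refl ← ≤-antisym a≤1+b (Fits.b<a F) =
    spread-sized F S (m∸n+n≡m (c<n F)) (m∸n+n≡m (Fits.a≤n F)) (m∸n+n≡m (spread-n≤c+b F S))
    where
    S : suc (suc b + b + c + d) ≡ n + n
    S = source-size {quad (suc b) b c d} size≡

  lower-missed-sized : ∀ {A B} → A + t ≡ n → B + 2 ≡ t → Sized n t m (quad n A B 0)
  lower-missed-sized {A} {B} EA EB = fits A<n B<A (inj₂ refl) ≤-refl (≤-reflexive EA) B+2t≤n 3t≤n
    , lower-size {quad n A B 0} size-eq
    where
    size-eq : suc (suc (n + A + B + 0)) ≡ n + n
    size-eq = ≡-linear (cong₂ _+_ EA EB) (solve (n ∷ t ∷ A ∷ B ∷ []))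
    A<n : A < n
    A<n = ≤-linear (≤-reflexive EA ⊕ ≤-reflexive EB ⊕ z≤n {B + 1}) (solve (n ∷ t ∷ A ∷ B ∷ []))
    B<A : B < A
    B<A = ≤-linear (≤-reflexive EB ⊕ ≤-reflexive (sym EA) ⊕ n-large ⊕ z≤n {11 + 4 * t + 6 * (t * t)})
      (solve (n ∷ t ∷ A ∷ B ∷ []))
    B+2t≤n : B + 2 * t ≤ n
    B+2t≤n = ≤-linear (≤-reflexive EB ⊕ 3t≤n ⊕ z≤n {2}) (solve (n ∷ t ∷ B ∷ []))

  spread-injective : ∀ {b c d b′ c′ d′} → Fits n t (quad (suc b) b c d) → Fits n t (quad (suc b′) b′ c′ d′) →
    size (quad (suc b) b c d) ≡ size (quad (suc b′) b′ c′ d′) →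
    n ∸ suc c ≡ n ∸ suc c′ → n ∸ suc b ≡ n ∸ suc b′ → quad (suc b) b c d ≡ quad (suc b′) b′ c′ d′
  spread-injective {b} {c} {d} F F′ size≡ c-eq b-eq
    with refl ← suc-injective (∸-cancelˡ-≡ (c<n F) (c<n F′) c-eq)
       | refl ← suc-injective (∸-cancelˡ-≡ (Fits.a≤n F) (Fits.a≤n F′) b-eq)
    = cong (quad (suc b) b c) (+-cancelˡ-≡ (suc b + b + c) _ _ size≡)

  lowerWith-injective : ∀ {q q′} (k : LowerCase q) (k′ : LowerCase q′) →
    Sized n t (suc m) q → Sized n t (suc m) q′ → lowerWith k ≡ lowerWith k′ → q ≡ q′
  lowerWith-injective (shrink (s≤s _)) (shrink (s≤s _)) _ _ refl = refl
  lowerWith-injective (shrink (s≤s _)) (spread _) (F , _) _ eq = contradiction (cong Quad.a eq) (<⇒≢ (Fits.a≤n F))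
  lowerWith-injective (spread _) (shrink (s≤s _)) _ (F′ , _) eq =
    contradiction (sym (cong Quad.a eq)) (<⇒≢ (Fits.a≤n F′))
  lowerWith-injective (spread a≤1+b) (spread a′≤1+b′) (F , size≡) (F′ , size≡′) eq
    with refl ← ≤-antisym a≤1+b (Fits.b<a F) | refl ← ≤-antisym a′≤1+b′ (Fits.b<a F′)
    = spread-injective F F′ (trans size≡ (sym size≡′)) (cong Quad.b eq) (cong Quad.c eq)

  lowerWith-misses : ∀ {q} (k : LowerCase q) → Sized n t (suc m) q → lowerWith k ≢ quad n (n ∸ t) (t ∸ 2) 0
  lowerWith-misses (shrink (s≤s _)) (F , _) eq = <⇒≢ (Fits.a≤n F) (cong Quad.a eq)
  lowerWith-misses {quad a b c d} (spread a≤1+b) (F , size≡) eq with refl ← ≤-antisym a≤1+b (Fits.b<a F) =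
    <⇒≢ (s≤s (spread-t≤c F (source-size {quad a b c d} size≡)))
        (sym (∸-cancelˡ-≡ (c<n F) t≤n (cong Quad.b eq)))

  lowering : QuadInjection n t (suc m) m
  lowering = record
    { to           = lower
    ; to-sized     = λ {q} → lowerWith-sized (lowerCase q)
    ; to-injective = λ {q} {q′} → lowerWith-injective (lowerCase q) (lowerCase q′)
    ; missed       = quad n (n ∸ t) (t ∸ 2) 0
    ; missed-sized = lower-missed-sized (m∸n+n≡m t≤n) (m∸n+n≡m 2≤t)
    ; to-misses    = λ {q} → lowerWith-misses (lowerCase q)
    }

  upper-size : ∀ {q} → size q ≡ n + n → size q ≡ suc (suc m)
  upper-size size≡ = trans size≡ (sym 2+m≡n+n)

  spare : ℕ → Quad
  spare u = quad (n ∸ u) (n ∸ suc u) (suc (u + u)) 0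

  spare-injective : ∀ {u v} → spare u ≡ spare v → u ≡ v
  spare-injective eq = x+x≡y+y⇒x≡y (suc-injective (cong Quad.c eq))

  data Move : Set where
    bump digits middle halves : Move

  data RaiseCase : Quad → Move → Set where
    bump   : ∀ {a b c d} → suc a ≤ n → RaiseCase (quad a b c d) bump
    digits : ∀ {a b c d} → n ≤ a → suc (suc c) ≤ t → RaiseCase (quad a b c d) digits
    middle : ∀ {a b c d} → n ≤ a → t ≤ suc c → 2 * c + d + 3 ≤ n → RaiseCase (quad a b c d) middle
    halves : ∀ {a b c d} → n ≤ a → t ≤ suc c → n < 2 * c + d + 3 → RaiseCase (quad a b c d) halves

  raiseCase : ∀ q → ∃ (RaiseCase q)
  raiseCase (quad a b c d) with suc a ≤? n
  ... | yes a<n = bump , bump a<n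
  ... | no  a≮n with suc (suc c) ≤? t
  ...   | yes 2+c≤t = digits , digits (≤-pred (≰⇒> a≮n)) 2+c≤t
  ...   | no  2+c≰t with 2 * c + d + 3 ≤? n
  ...     | yes room = middle , middle (≤-pred (≰⇒> a≮n)) (≤-pred (≰⇒> 2+c≰t)) room
  ...     | no  full = halves , halves (≤-pred (≰⇒> a≮n)) (≤-pred (≰⇒> 2+c≰t)) (≰⇒> full)

  -- The digits case stores (c, d) as the base-t expansion d + c·t, as d < c < t; the halves case
  -- stores ⌊d/2⌋, which with the parity of d = n − 2c − 2 determines (c, d).
  raiseWith : ∀ {q β} → RaiseCase q β → Quad
  raiseWith {quad a b c d} (bump _)       = quad (suc a) b c d
  raiseWith {quad a b c d} (digits _ _)   = spare (t + (d + c * t))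
  raiseWith {quad a b c d} (middle _ _ _) = quad (n ∸ c) (n ∸ suc c) (suc (c + d)) (c ∸ d)
  raiseWith {quad a b c d} (halves _ _ _) = spare (t + t * t + ⌊ d /2⌋)

  raise : Quad → Quad
  raise q = raiseWith (proj₂ (raiseCase q))

  spare-sized : ∀ {u} → t ≤ suc u → 3 * u + 3 ≤ n → 2 * u + 1 + 2 * t ≤ n → Sized n t (suc (suc m)) (spare u)
  spare-sized {u} U₁ U₂ U₃ = sized (m∸n+n≡m (<⇒≤ u<n)) (m∸n+n≡m u<n)
    where
    u<n : u < n
    u<n = ≤-linear (U₂ ⊕ z≤n {2 * u + 2}) (solve (n ∷ u ∷ []))
    sized : ∀ {s₁ s₂} → s₁ + u ≡ n → s₂ + suc u ≡ n → Sized n t (suc (suc m)) (quad s₁ s₂ (suc (u + u)) 0)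
    sized {s₁} {s₂} E₁ E₂ = fits s₂<s₁ 1+2u<s₂ (inj₂ refl) s₁≤n s₂+t≤n 1+2u+2t≤n 3t≤n
                         , upper-size {quad s₁ s₂ (suc (u + u)) 0} size-eq
      where
      s₂<s₁ : s₂ < s₁
      s₂<s₁ = ≤-linear (≤-reflexive E₂ ⊕ ≤-reflexive (sym E₁)) (solve (n ∷ u ∷ s₁ ∷ s₂ ∷ []))
      1+2u<s₂ : suc (u + u) < s₂
      1+2u<s₂ = ≤-linear (U₂ ⊕ ≤-reflexive (sym E₂)) (solve (n ∷ u ∷ s₂ ∷ []))
      s₁≤n : s₁ ≤ n
      s₁≤n = ≤-linear (≤-reflexive E₁ ⊕ z≤n {u}) (solve (n ∷ u ∷ s₁ ∷ []))
      s₂+t≤n : s₂ + t ≤ n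
      s₂+t≤n = ≤-linear (≤-reflexive E₂ ⊕ U₁) (solve (n ∷ t ∷ u ∷ s₂ ∷ []))
      1+2u+2t≤n : suc (u + u) + 2 * t ≤ n
      1+2u+2t≤n = ≤-linear U₃ (solve (n ∷ t ∷ u ∷ []))
      size-eq : s₁ + s₂ + suc (u + u) + 0 ≡ n + n
      size-eq = ≡-linear (cong₂ _+_ E₁ E₂) (solve (n ∷ u ∷ s₁ ∷ s₂ ∷ []))

  first-full : ∀ {a b c d} → Sized n t (suc m) (quad a b c d) → n ≤ a → a ≡ n
  first-full (F , _) n≤a = ≤-antisym (Fits.a≤n F) n≤a

  first-full-size : ∀ {b c d} → Sized n t (suc m) (quad n b c d) → suc (n + b + c + d) ≡ n + n
  first-full-size {b} {c} {d} (_ , size≡) = source-size {quad n b c d} size≡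

  first-full⇒2c+d+2≤n : ∀ {b c d} → Sized n t (suc m) (quad n b c d) → 2 * c + d + 2 ≤ n
  first-full⇒2c+d+2≤n {b} {c} {d} s@(F , _) = ≤-linear (Fits.c<b F ⊕ ≤-reflexive S) (solve (n ∷ b ∷ c ∷ d ∷ []))
    where
    S : suc (n + b + c + d) ≡ n + n
    S = first-full-size s

  first-full⇒d<c : ∀ {b c d} → Sized n t (suc m) (quad n b c d) → d < c
  first-full⇒d<c {b} {c} {d} s@(F , _) = [ id , from-d≡0 ]′ (Fits.d<c⊎d≡0 F)
    where
    S : suc (n + b + c + d) ≡ n + n
    S = first-full-size s
    t≤1+c+d : t ≤ c + d + 1
    t≤1+c+d = ≤-linear (Fits.b+t≤n F ⊕ ≤-reflexive (sym S)) (solve (n ∷ t ∷ b ∷ c ∷ d ∷ []))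
    from-d≡0 : d ≡ 0 → d < c
    from-d≡0 d≡0 = ≤-linear (2≤t ⊕ t≤1+c+d ⊕ ≤-reflexive d≡0 ⊕ ≤-reflexive d≡0) (solve (t ∷ c ∷ d ∷ []))

  first-full⇒2c+d+2≡n : ∀ {b c d} → Sized n t (suc m) (quad n b c d) → n < 2 * c + d + 3 → 2 * c + d + 2 ≡ n
  first-full⇒2c+d+2≡n {b} {c} {d} s n<2c+d+3 =
    ≤-antisym (first-full⇒2c+d+2≤n s) (≤-linear n<2c+d+3 (solve (n ∷ c ∷ d ∷ [])))

  digits-d<t : ∀ {c d} → suc (suc c) ≤ t → d < c → d < t
  digits-d<t {c} 2+c≤t d<c = <-trans d<c (≤-trans (n≤1+n (suc c)) 2+c≤t)

  digits-bound : ∀ {c d} → suc (suc c) ≤ t → d < c → d + c * t < t * t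
  digits-bound {c} {d} 2+c≤t d<c = ≤-linear (d<t ⊕ [1+c]t≤tt) (solve (t ∷ c ∷ d ∷ []))
    where
    d<t : d < t
    d<t = digits-d<t 2+c≤t d<c
    [1+c]t≤tt : suc c * t ≤ t * t
    [1+c]t≤tt = *-monoˡ-≤ t (≤-trans (n≤1+n (suc c)) 2+c≤t)

  digits-sized : ∀ {c d} → suc (suc c) ≤ t → d < c → Sized n t (suc (suc m)) (spare (t + (d + c * t)))
  digits-sized {c} {d} 2+c≤t d<c = spare-sized U₁ U₂ U₃
    where
    d+ct<tt : d + c * t < t * t
    d+ct<tt = digits-bound 2+c≤t d<c
    U₁ : t ≤ suc (t + (d + c * t))
    U₁ = ≤-linear (z≤n {1 + d + c * t}) (solve (t ∷ c ∷ d ∷ []))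
    U₂ : 3 * (t + (d + c * t)) + 3 ≤ n
    U₂ = ≤-linear (d+ct<tt ⊕ d+ct<tt ⊕ d+ct<tt ⊕ n-large ⊕ z≤n {10 + 3 * t + 3 * (t * t)}) (solve (n ∷ t ∷ c ∷ d ∷ []))
    U₃ : 2 * (t + (d + c * t)) + 1 + 2 * t ≤ n
    U₃ = ≤-linear (d+ct<tt ⊕ d+ct<tt ⊕ n-large ⊕ z≤n {11 + 2 * t + 4 * (t * t)}) (solve (n ∷ t ∷ c ∷ d ∷ []))

  halves-sized : ∀ {c d h} → 2 * c + d + 2 ≤ n → d < c → h + h ≤ d →
    Sized n t (suc (suc m)) (spare (t + t * t + h))
  halves-sized {c} {d} {h} 2c+d+2≤n d<c h+h≤d = spare-sized U₁ U₂ U₃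
    where
    U₁ : t ≤ suc (t + t * t + h)
    U₁ = ≤-linear (z≤n {1 + t * t + h}) (solve (t ∷ h ∷ []))
    U₂ : 3 * (t + t * t + h) + 3 ≤ n
    U₂ = ≤-linear-scaled 1 (h+h≤d ⊕ h+h≤d ⊕ h+h≤d ⊕ d<c ⊕ d<c ⊕ 2c+d+2≤n ⊕ n-large ⊕ z≤n {8})
      (solve (n ∷ t ∷ c ∷ d ∷ h ∷ []))
    U₃ : 2 * (t + t * t + h) + 1 + 2 * t ≤ n
    U₃ = ≤-linear-scaled 2 (h+h≤d ⊕ h+h≤d ⊕ h+h≤d ⊕ d<c ⊕ d<c ⊕ 2c+d+2≤n ⊕ n-large ⊕ n-large ⊕ z≤n {21 + 6 * (t * t)})
      (solve (n ∷ t ∷ c ∷ d ∷ h ∷ []))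

  middle-sized : ∀ {c d} → t ≤ suc c → 2 * c + d + 3 ≤ n → d < c →
    Sized n t (suc (suc m)) (quad (n ∸ c) (n ∸ suc c) (suc (c + d)) (c ∸ d))
  middle-sized {c} {d} t≤1+c room d<c = sized (m∸n+n≡m c≤n) (m∸n+n≡m 1+c≤n) (m∸n+n≡m (<⇒≤ d<c))
    where
    1+c≤n : suc c ≤ n
    1+c≤n = ≤-linear (room ⊕ z≤n {c + d + 2}) (solve (n ∷ c ∷ d ∷ []))
    c≤n : c ≤ n
    c≤n = <⇒≤ 1+c≤n
    sized : ∀ {o₁ o₂ o₄} → o₁ + c ≡ n → o₂ + suc c ≡ n → o₄ + d ≡ c →
      Sized n t (suc (suc m)) (quad o₁ o₂ (suc (c + d)) o₄)
    sized {o₁} {o₂} {o₄} E₁ E₂ E₄ = fits o₂<o₁ 1+c+d<o₂ (inj₁ o₄<1+c+d) o₁≤n o₂+t≤n 1+c+d+2t≤n o₄+3t≤n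
                                  , upper-size {quad o₁ o₂ (suc (c + d)) o₄} size-eq
      where
      o₂<o₁ : o₂ < o₁
      o₂<o₁ = ≤-linear (≤-reflexive E₂ ⊕ ≤-reflexive (sym E₁)) (solve (n ∷ c ∷ o₁ ∷ o₂ ∷ []))
      1+c+d<o₂ : suc (c + d) < o₂
      1+c+d<o₂ = ≤-linear (room ⊕ ≤-reflexive (sym E₂)) (solve (n ∷ c ∷ d ∷ o₂ ∷ []))
      o₄<1+c+d : o₄ < suc (c + d)
      o₄<1+c+d = s≤s (≤-linear (≤-reflexive E₄ ⊕ z≤n {d + d}) (solve (c ∷ d ∷ o₄ ∷ [])))
      o₁≤n : o₁ ≤ n
      o₁≤n = ≤-linear (≤-reflexive E₁ ⊕ z≤n {c}) (solve (n ∷ c ∷ o₁ ∷ []))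
      o₂+t≤n : o₂ + t ≤ n
      o₂+t≤n = ≤-linear (≤-reflexive E₂ ⊕ t≤1+c) (solve (n ∷ t ∷ c ∷ o₂ ∷ []))
      1+c+d+2t≤n : suc (c + d) + 2 * t ≤ n
      1+c+d+2t≤n = ≤-linear-scaled 2 (d<c ⊕ room ⊕ room ⊕ n-large ⊕ z≤n {14 + 6 * (t * t)})
        (solve (n ∷ t ∷ c ∷ d ∷ []))
      o₄+3t≤n : o₄ + 3 * t ≤ n
      o₄+3t≤n = ≤-linear-scaled 1 (≤-reflexive E₄ ⊕ ≤-reflexive E₄ ⊕ room ⊕ n-large ⊕ z≤n {13 + 3 * d + 6 * (t * t)})
        (solve (n ∷ t ∷ c ∷ d ∷ o₄ ∷ []))
      size-eq : o₁ + o₂ + suc (c + d) + o₄ ≡ n + n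
      size-eq = ≡-linear (cong₂ _+_ (cong₂ _+_ E₁ E₂) E₄) (solve (n ∷ c ∷ d ∷ o₁ ∷ o₂ ∷ o₄ ∷ []))

  raiseWith-sized : ∀ {q β} (k : RaiseCase q β) → Sized n t (suc m) q → Sized n t (suc (suc m)) (raiseWith k)
  raiseWith-sized (bump a<n) (fits b<a c<b d<c⊎d≡0 _ b+t≤n c+2t≤n d+3t≤n , size≡) =
    fits (m<n⇒m<1+n b<a) c<b d<c⊎d≡0 a<n b+t≤n c+2t≤n d+3t≤n , cong suc size≡
  raiseWith-sized (digits n≤a 2+c≤t) s with refl ← first-full s n≤a =
    digits-sized 2+c≤t (first-full⇒d<c s)
  raiseWith-sized (middle n≤a t≤1+c room) s with refl ← first-full s n≤a =
    middle-sized t≤1+c room (first-full⇒d<c s)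
  raiseWith-sized {quad a b c d} (halves n≤a _ _) s with refl ← first-full s n≤a =
    halves-sized (first-full⇒2c+d+2≤n s) (first-full⇒d<c s) (⌊n/2⌋+⌊n/2⌋≤n d)

  ImageOf : Move → Quad → Set
  ImageOf bump   (quad x y _ _) = suc (suc y) ≤ x
  ImageOf middle (quad x y _ w) = x ≤ suc y × w ≢ 0
  ImageOf digits q              = ∃[ u ] (q ≡ spare u × t ≤ u × u < t + t * t)
  ImageOf halves q              = ∃[ u ] (q ≡ spare u × t + t * t ≤ u)

  raiseWith-image : ∀ {q β} (k : RaiseCase q β) → Sized n t (suc m) q → ImageOf β (raiseWith k)
  raiseWith-image (bump _) (F , _) = s≤s (Fits.b<a F)
  raiseWith-image (digits n≤a 2+c≤t) s with refl ← first-full s n≤a =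
    _ , refl , m≤m+n t _ , +-monoʳ-< t (digits-bound 2+c≤t (first-full⇒d<c s))
  raiseWith-image {quad a b c d} (middle n≤a _ _) s with refl ← first-full s n≤a =
    m∸n≤1+m∸[1+n] n c , m>n⇒m∸n≢0 (first-full⇒d<c s)
  raiseWith-image (halves _ _ _) _ = _ , refl , m≤m+n _ _

  -- The case that produced an image can be read off from the image, so injectivity of raise
  -- reduces to injectivity within each case.
  branchOf : Quad → Move
  branchOf (quad x y z w) =
    if does (suc (suc y) ≤? x) then bump
    else if does (w ≟ 0) then (if does (z <? (t + t * t) + (t + t * t)) then digits else halves)
    else middle

  branchOf-image : ∀ β q → ImageOf β q → branchOf q ≡ β
  branchOf-image bump (quad x y z w) gap rewrite dec-true (suc (suc y) ≤? x) gap = refl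
  branchOf-image middle (quad x y z w) (x≤1+y , w≢0)
    rewrite dec-false (suc (suc y) ≤? x) (<⇒≱ (s≤s x≤1+y)) | dec-false (w ≟ 0) w≢0 = refl
  branchOf-image digits _ (u , refl , _ , u<T)
    rewrite dec-false (suc (suc (n ∸ suc u)) ≤? n ∸ u) (<⇒≱ (s≤s (m∸n≤1+m∸[1+n] n u)))
          | dec-true (suc (u + u) <? (t + t * t) + (t + t * t)) (x<y⇒1+x+x<y+y u<T) = refl
  branchOf-image halves _ (u , refl , T≤u)
    rewrite dec-false (suc (suc (n ∸ suc u)) ≤? n ∸ u) (<⇒≱ (s≤s (m∸n≤1+m∸[1+n] n u)))
          | dec-false (suc (u + u) <? (t + t * t) + (t + t * t)) (<⇒≱ (y≤x⇒y+y<2+x+x T≤u)) = refl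

  raiseWith-injective-within : ∀ {q q′ β} (k : RaiseCase q β) (k′ : RaiseCase q′ β) →
    Sized n t (suc m) q → Sized n t (suc m) q′ → raiseWith k ≡ raiseWith k′ → q ≡ q′
  raiseWith-injective-within (bump _) (bump _) _ _ refl = refl
  raiseWith-injective-within {quad _ _ c d} {quad _ _ c′ d′}
    (digits n≤a 2+c≤t) (digits n≤a′ 2+c′≤t) s@(_ , size≡) s′@(_ , size≡′) eq
    with refl ← first-full s n≤a | refl ← first-full s′ n≤a′
    with refl , refl ← digits-injective {t} {c} {d} {c′} {d′}
           (digits-d<t 2+c≤t (first-full⇒d<c s)) (digits-d<t 2+c′≤t (first-full⇒d<c s′))
           (+-cancelˡ-≡ t _ _ (spare-injective eq))
    = quad-≡-by-size (trans size≡ (sym size≡′))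
  raiseWith-injective-within {quad _ _ c _} (middle n≤a _ _) (middle n≤a′ _ _) s@(F , size≡) s′@(F′ , size≡′) eq
    with refl ← first-full s n≤a | refl ← first-full s′ n≤a′
    with refl ← ∸-cancelˡ-≡ (<⇒≤ (c<n F)) (<⇒≤ (c<n F′)) (cong Quad.a eq)
    with refl ← +-cancelˡ-≡ c _ _ (suc-injective (cong Quad.c eq))
    = quad-≡-by-size (trans size≡ (sym size≡′))
  raiseWith-injective-within {quad _ _ c d} {quad _ _ c′ d′}
    (halves n≤a _ full) (halves n≤a′ _ full′) s@(_ , size≡) s′@(_ , size≡′) eq
    with refl ← first-full s n≤a | refl ← first-full s′ n≤a′
    with 2c+d≡2c′+d′ ← +-cancelʳ-≡ 2 (2 * c + d) (2 * c′ + d′)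
           (trans (first-full⇒2c+d+2≡n s full) (sym (first-full⇒2c+d+2≡n s′ full′)))
    with refl ← ⌊/2⌋-injective-within-parity {c} {c′} d d′ 2c+d≡2c′+d′
                  (+-cancelˡ-≡ (t + t * t) ⌊ d /2⌋ ⌊ d′ /2⌋ (spare-injective eq))
    with refl ← *-cancelˡ-≡ c c′ 2 (+-cancelʳ-≡ d _ _ 2c+d≡2c′+d′)
    = quad-≡-by-size (trans size≡ (sym size≡′))

  raiseWith-injective : ∀ {q q′ β β′} (k : RaiseCase q β) (k′ : RaiseCase q′ β′) →
    Sized n t (suc m) q → Sized n t (suc m) q′ → raiseWith k ≡ raiseWith k′ → q ≡ q′
  raiseWith-injective {β = β} {β′} k k′ s s′ eq
    with refl ← trans (sym (branchOf-image β _ (raiseWith-image k s)))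
                      (trans (cong branchOf eq) (branchOf-image β′ _ (raiseWith-image k′ s′)))
    = raiseWith-injective-within k k′ s s′ eq

  raise-missed-sized : ∀ {u} → suc u ≡ t → Sized n t (suc (suc m)) (spare u)
  raise-missed-sized {u} 1+u≡t = spare-sized (≤-reflexive (sym 1+u≡t)) U₂ U₃
    where
    U₂ : 3 * u + 3 ≤ n
    U₂ = ≤-linear (≤-reflexive 1+u≡t ⊕ ≤-reflexive 1+u≡t ⊕ ≤-reflexive 1+u≡t ⊕ 3t≤n) (solve (n ∷ t ∷ u ∷ []))
    U₃ : 2 * u + 1 + 2 * t ≤ n
    U₃ = ≤-linear (≤-reflexive 1+u≡t ⊕ ≤-reflexive 1+u≡t ⊕ n-large ⊕ z≤n {11 + 2 * t + 6 * (t * t)})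
      (solve (n ∷ t ∷ u ∷ []))

  image-≢-missed : ∀ β {q} → ImageOf β q → q ≢ spare (pred t)
  image-≢-missed bump   {quad x y z w} gap refl = <⇒≱ (s≤s (m∸n≤1+m∸[1+n] n (pred t))) gap
  image-≢-missed middle {quad x y z w} (_ , w≢0) eq = w≢0 (cong Quad.d eq)
  image-≢-missed digits (u , refl , t≤u , _) eq =
    1+n≰n (subst (_≤ pred t) (sym (suc-pred t)) (subst (t ≤_) (spare-injective eq) t≤u))
  image-≢-missed halves (u , refl , T≤u) eq =
    1+n≰n (subst (_≤ pred t) (sym (suc-pred t)) (subst (t ≤_) (spare-injective eq) (≤-trans (m≤m+n t _) T≤u)))

  raising : QuadInjection n t (suc m) (suc (suc m))
  raising = record
    { to           = raise
    ; to-sized     = λ {q} → raiseWith-sized (proj₂ (raiseCase q))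
    ; to-injective = λ {q} {q′} → raiseWith-injective (proj₂ (raiseCase q)) (proj₂ (raiseCase q′))
    ; missed       = spare (pred t)
    ; missed-sized = raise-missed-sized (suc-pred t)
    ; to-misses    = λ {q} s → image-≢-missed _ (raiseWith-image (proj₂ (raiseCase q)) s)
    }

theorem2p5 : ∀ (t : ℕ) → 2 ≤ t →
    ∃[ N ] (∀ (n : ℕ) → N ≤ n →
      ¬ Unimodal (rankGenCoeff (n ∷ (n ∸ t) ∷ (n ∸ 2 * t) ∷ (n ∸ 3 * t) ∷ [])))
theorem2p5 t 2≤t = 6 * (t * t) + 6 * t + 10 , not-unimodal
  where
  not-unimodal : ∀ n → 6 * (t * t) + 6 * t + 10 ≤ n → ¬ Unimodal (rankGenCoeff (shape n t))
  not-unimodal n n-large = dip⇒¬Unimodal (n + n ∸ 2)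
      (rankGenCoeff-<-by-injection 3t≤n n<1+m lowering)
      (rankGenCoeff-<-by-injection 3t≤n n<1+m raising)
    where
    1≤n : 1 ≤ n
    1≤n = ≤-trans (s≤s z≤n) (≤-trans (m≤n+m 10 (6 * (t * t) + 6 * t)) n-large)
    open Construction 2≤t n-large (m+[n∸m]≡n (+-mono-≤ 1≤n 1≤n))
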